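{- Let $B$ be a plane hyper-bouquet. Then ${}^{\partial}\varepsilon_{B}(z)=2^{e(B)}$.
   Context: A ribbon hypermap $H$ is a (possibly non-orientable) surface with boundary, written as the union of two sets of discs, the hypervertices $V(H)$ and the hyperedges $E(H)$, such that hypervertices and hyperedges meet in disjoint line segments (common line segments), each lying on the boundary of exactly one hypervertex and exactly one hyperedge. Hyperfaces are the boundary components of the surface. $v(H),e(H),f(H),k(H)$ are the numbers of hypervertices, hyperedges, hyperfaces and connected components; $d(e)$ is the number of common line segments on hyperedge $e$ and $d(H)=\sum_e d(e)$. The Euler genus is $\varepsilon(H)=2k(H)+d(H)-v(H)-e(H)-f(H)$. $H$ is plane if it is connected and $\varepsilon(H)=0$. A hyper-bouquet is a ribbon hypermap with exactly one hypervertex. Partial dual $H^A$ ($A\subseteq E(H)$): in an arrow presentation of $H$ (hypervertices as closed curves; each hyperedge $e$ as arrows $e_1,\dots,e_{d(e)}$ along its common line segments in cyclic order around $e$), for each $e\in A$ and each $i$ draw a new arrow from the head of $e_i$ to the tail of $e_{i+1}$ (indices mod $d(e)$), label it $e_i$, and delete the original arrows; the new arrows become arcs of the closed curves of the arrow presentation of $H^A$. The partial-dual polynomial is ${}^{\partial}\varepsilon_{H}(z)=\sum_{A\subseteq E(H)} z^{\varepsilon(H^A)}$. -}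

module Defs where

open import Data.Nat as ℕ using (ℕ; zero; suc; _+_; _*_)
open import Data.Integer as ℤ using (ℤ; +_; _-_)
open import Data.Fin as Fin using (Fin; zero; suc; fromℕ; inject₁)
open import Data.Fin.Properties as FinP using ()
open import Data.Bool using (Bool; true; false; if_then_else_)
open import Data.List using (List; []; _∷_; _++_; map; concatMap; length; allFin; foldr)
open import Data.Product using (Σ; _×_; _,_; proj₁; proj₂)
import Data.Product.Properties as ProdP
open import Relation.Binary.PropositionalEquality using (_≡_; _≢_; refl)
open import Relation.Binary.Definitions using (DecidableEquality)
open import Relation.Nullary using (yes; no; does)

module Orbits {X : Set} (_≟_ : DecidableEquality X) where

  member : X → List X → Bool
  member x []       = false
  member x (y ∷ ys) = if does (x ≟ y) then true else member x ys

  insert : X → List X → List X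
  insert x S = if member x S then S else x ∷ S

  step : List (X → X) → List X → List X
  step gens S = foldr insert S (concatMap (λ g → map g S) gens)

  closure : ℕ → List (X → X) → List X → List X
  closure zero    gens S = S
  closure (suc n) gens S = closure n gens (step gens S)

  -- the orbit of x under the group generated by gens (the generators used
  -- here are involutions); `fuel` = size of the finite set suffices
  orbit : ℕ → List (X → X) → X → List X
  orbit fuel gens x = closure fuel gens (x ∷ [])

  countOrbits : List X → List (X → X) → ℕ
  countOrbits xs gens = go [] xs
    where
    go : List X → List X → ℕ
    go seen []       = zero
    go seen (x ∷ rs) = if member x seen then go seen rs
                       else suc (go (orbit (length xs) gens x ++ seen) rs)

cycSuc : ∀ {n} → Fin n → Fin n
cycSuc {suc zero}    zero    = zero
cycSuc {suc (suc n)} zero    = suc zero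
cycSuc {suc (suc n)} (suc i) with cycSuc {suc n} i
... | zero  = zero
... | suc j = suc (suc j)

cycPred : ∀ {n} → Fin n → Fin n
cycPred {suc n} zero    = fromℕ n
cycPred {suc n} (suc i) = inject₁ i

data End : Set where
  tail head : End

End-≟ : DecidableEquality End
End-≟ tail tail = yes refl
End-≟ tail head = no (λ ())
End-≟ head tail = no (λ ())
End-≟ head head = yes refl

-- Arrows e_i : hyperedge e ∈ Fin m, index i ∈ Fin (d e) (cyclic order around e).
Arrow : (m : ℕ) → (Fin m → ℕ) → Set
Arrow m d = Σ (Fin m) (λ e → Fin (d e))

-- An arrow end (a point of a closed curve where an arrow starts or stops).
Flag : (m : ℕ) → (Fin m → ℕ) → Set
Flag m d = Arrow m d × End

-- An arrow presentation of a ribbon hypermap: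
--  * m hyperedges, hyperedge e having d e common line segments
--    (arrows e_0, …, e_{d e - 1} in cyclic order around e);
--  * the closed curves (hypervertices) are encoded by `rv`, pairing each
--    arrow end with the arrow end reached by following the curve (outside the
--    arrows) to the next arrow end; a closed curve is thus an orbit of ⟨rs, rv⟩
--    where rs swaps the two ends of an arrow;
--  * `iso` closed curves carry no arrows at all.
-- Arrow directions relative to the curves are arbitrary, so non-orientable
-- surfaces are included.
record RibbonHypermap : Set where
  field
    m   : ℕ
    d   : Fin m → ℕ
    iso : ℕ
    rv  : Flag m d → Flag m d

open RibbonHypermap public

WellFormed : RibbonHypermap → Set
WellFormed H = (∀ x → rv H (rv H x) ≡ x) × (∀ x → rv H x ≢ x)

Flag-≟ : ∀ {m} {d : Fin m → ℕ} → DecidableEquality (Flag m d)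
Flag-≟ = ProdP.≡-dec (ProdP.≡-dec FinP._≟_ FinP._≟_) End-≟

allFlags : (m : ℕ) (d : Fin m → ℕ) → List (Flag m d)
allFlags m d = concatMap (λ e → concatMap (λ i → ((e , i) , tail) ∷ ((e , i) , head) ∷ [])
                                           (allFin (d e)))
                         (allFin m)

rs : ∀ {m} {d : Fin m → ℕ} → Flag m d → Flag m d
rs (a , tail) = a , head
rs (a , head) = a , tail

-- re : the boundary arc of hyperedge e from head of e_i to tail of e_{i+1}
re : ∀ {m} {d : Fin m → ℕ} → Flag m d → Flag m d
re ((e , i) , head) = (e , cycSuc i) , tail
re ((e , i) , tail) = (e , cycPred i) , head

-- hyperedges with no common line segment (isolated discs)
countZeroDeg : (m : ℕ) → (Fin m → ℕ) → ℕ
countZeroDeg m d = foldr (λ e n → isZ (d e) + n) 0 (allFin m)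
  where
  isZ : ℕ → ℕ
  isZ zero    = 1
  isZ (suc _) = 0

module _ (H : RibbonHypermap) where
  private
    module O = Orbits (Flag-≟ {m H} {d H})
    FL = allFlags (m H) (d H)

  v# : ℕ
  v# = O.countOrbits FL (rs ∷ rv H ∷ []) + iso H

  e# : ℕ
  e# = m H

  f# : ℕ
  f# = O.countOrbits FL (rv H ∷ re ∷ []) + countZeroDeg (m H) (d H)

  k# : ℕ
  k# = O.countOrbits FL (rs ∷ rv H ∷ re ∷ []) + iso H + countZeroDeg (m H) (d H)

  d# : ℕ
  d# = foldr (λ e n → d H e + n) 0 (allFin (m H))

  eulerGenus : ℤ
  eulerGenus = + (2 * k# + d#) - + (v# + e# + f#)

IsPlane : RibbonHypermap → Set
IsPlane H = (k# H ≡ 1) × (eulerGenus H ≡ + 0)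

IsHyperBouquet : RibbonHypermap → Set
IsHyperBouquet H = v# H ≡ 1

EdgeSubset : ℕ → Set
EdgeSubset m = Fin m → Bool

allSubsets : (m : ℕ) → List (EdgeSubset m)
allSubsets zero    = (λ ()) ∷ []
allSubsets (suc m) = concatMap (λ A → ext false A ∷ ext true A ∷ []) (allSubsets m)
  where
  ext : Bool → EdgeSubset m → EdgeSubset (suc m)
  ext b A zero    = b
  ext b A (suc i) = A i

-- For e ∈ A the new arrow e_i runs from the head of the old e_i to the tail
-- of the old e_{i+1}.  φ sends an arrow end of H^A to the point of the curves
-- it sits at, named as an arrow end of H; φ⁻¹ is its inverse.
module _ {m} {d : Fin m → ℕ} (A : EdgeSubset m) where
  φ : Flag m d → Flag m d
  φ ((e , i) , tail) = if A e then ((e , i) , head) else ((e , i) , tail)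
  φ ((e , i) , head) = if A e then ((e , cycSuc i) , tail) else ((e , i) , head)

  φ⁻¹ : Flag m d → Flag m d
  φ⁻¹ ((e , i) , head) = if A e then ((e , i) , tail) else ((e , i) , head)
  φ⁻¹ ((e , i) , tail) = if A e then ((e , cycPred i) , head) else ((e , i) , tail)

-- the partial dual H^A: same hyperedges and degrees; the closed curves are the
-- old curves with the arrows of A deleted and the new arrows inserted
partialDual : (H : RibbonHypermap) → EdgeSubset (m H) → RibbonHypermap
partialDual H A = record
  { m   = m H
  ; d   = d H
  ; iso = iso H
  ; rv  = λ x → φ⁻¹ A (rv H (φ A x))
  }

count : ∀ {X : Set} → (X → Bool) → List X → ℕ
count p []       = 0
count p (x ∷ xs) = if p x then suc (count p xs) else count p xs

-- coefficient of z^k in ∂ε_H(z) = Σ_{A ⊆ E(H)} z^{ε(H^A)}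
partialDualPoly : RibbonHypermap → ℕ → ℕ
partialDualPoly H k =
  count (λ A → does (eulerGenus (partialDual H A) ℤ.≟ + k)) (allSubsets (m H))

constPoly : ℕ → ℕ → ℕ
constPoly c zero    = c
constPoly c (suc _) = 0

{-# OPTIONS --safe #-}

-- Read the partial dual H^A inside H: the bijection φ A between arrow ends
-- turns the arrow swap rs of H^A into rs⟨ A ⟩, which is the boundary arc re on
-- hyperedges in A and rs elsewhere, and turns re into rs⟨ ∁ A ⟩.  Hence H^A has
-- the components of H, and its hypervertices and hyperfaces carrying arrows are
-- counted by ν A and ν (∁ A), where ν A is the number of orbits of
-- ⟨rs⟨ A ⟩, rv⟩.  Changing A at one hyperedge e only joins orbits through the
-- arrow ends of e, and these lie in at most d(e) orbits; so ν A ≤ ν B + Σ (d(e) − 1)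
-- over the e where A and B differ.  For a plane hyper-bouquet, Euler's formula
-- gives the extreme case ν full = ν ∅ + Σₑ (d(e) − 1), which forces
-- ν A = ν ∅ + Σ_{e ∈ A} (d(e) − 1) for all A.  Then v(H^A) + f(H^A) = v(H) + f(H),
-- so every partial dual is plane.

module Submission where

open import Defs
open import Algebra.Definitions using (Involutive)
open import Data.Bool using (Bool; true; false; if_then_else_; not; T; _∨_; _∧_)
open import Data.Bool.ListAction using (any)
open import Data.Bool.Properties using (T-≡; T-∨; T-∧; not-injective)
open import Data.Empty using (⊥-elim)
open import Data.Fin as Fin using (Fin; zero; suc; fromℕ; inject₁)
import Data.Integer as ℤ
import Data.Integer.Properties as ℤ
open import Data.List using (List; []; _∷_; _++_; map; concatMap; length; foldr; filterᵇ; allFin)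
open import Data.List.Membership.Propositional using (_∈_; _∉_; lose; find)
open import Data.List.Membership.Propositional.Properties
  using (∈-++⁺ˡ; ∈-++⁺ʳ; ∈-++⁻; ∈-map⁺; ∈-map⁻; ∈-concatMap⁺; ∈-filter⁺; ∈-filter⁻;
         ∈-allFin)
open import Data.List.Properties
  using (length-map; length-tabulate; map-∘; filter-accept; filter-reject; filter-all; filter-≐)
open import Data.List.Relation.Binary.Pointwise using (Pointwise; []; _∷_)
open import Data.List.Relation.Unary.All as All using (All; []; _∷_)
open import Data.List.Relation.Unary.All.Properties using (¬Any⇒All¬)
open import Data.List.Relation.Unary.Any as Any using (Any; here; there)
open import Data.List.Relation.Unary.Any.Properties using (any⁺; any⁻)
open import Data.List.Relation.Unary.Unique.Propositional using (Unique; []; _∷_)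
open import Data.Nat using (ℕ; zero; suc; _+_; _*_; _∸_; _^_; _≤_; _<_; z≤n; s≤s)
open import Data.Nat.ListAction using (sum)
import Data.Nat.Properties as ℕ
open import Data.Nat.Tactic.RingSolver using (solve-∀)
open import Algebra.Properties.CommutativeSemigroup ℕ.+-commutativeSemigroup using (x∙yz≈y∙xz)
open import Data.Product using (∃-syntax; _×_; _,_; proj₁; proj₂)
open import Data.Sum using (_⊎_; inj₁; inj₂; map₂)
open import Data.Vec.Functional using (updateAt)
open import Data.Vec.Functional.Properties using (updateAt-updates; updateAt-minimal)
open import Function using (id; _∘_; _⇔_; Equivalence; mk⇔)
open import Relation.Binary.Construct.Closure.ReflexiveTransitive as Star
  using (Star; ε; _◅_; _◅◅_)
open import Relation.Binary.Definitions using (DecidableEquality)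
open import Relation.Binary.PropositionalEquality
  using (_≡_; _≢_; refl; sym; trans; cong; cong₂; subst; subst₂; module ≡-Reasoning)
open import Relation.Binary.Structures using (IsEquivalence)
open import Relation.Nullary using (yes; no; does; ¬_)
open import Relation.Nullary.Decidable using (T?)

module _ {A : Set} where

  ∈⇒deletion : ∀ {L : List A} {x} → x ∈ L →
               ∃[ L′ ] length L ≡ suc (length L′) × (∀ {y} → y ∈ L → y ≢ x → y ∈ L′)
  ∈⇒deletion {z ∷ L} (here refl) = L , refl , keep
    where
    keep : ∀ {y} → y ∈ z ∷ L → y ≢ z → y ∈ L
    keep (here refl) y≢z = ⊥-elim (y≢z refl)
    keep (there y∈L) _   = y∈L
  ∈⇒deletion {z ∷ L} {x} (there x∈L) with ∈⇒deletion x∈L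
  ... | L′ , len , keep = z ∷ L′ , cong suc len , keep′
    where
    keep′ : ∀ {y} → y ∈ z ∷ L → y ≢ x → y ∈ z ∷ L′
    keep′ (here refl) _   = here refl
    keep′ (there y∈L) y≢x = there (keep y∈L y≢x)

  pigeonhole : ∀ {S L : List A} → Unique S → (∀ {y} → y ∈ S → y ∈ L) → length S ≤ length L
  pigeonhole {[]}    _          _   = z≤n
  pigeonhole {x ∷ S} (x≢S ∷ u) S⊆L with ∈⇒deletion (S⊆L (here refl))
  ... | L′ , len , keep rewrite len =
    s≤s (pigeonhole u (λ y∈S → keep (S⊆L (there y∈S)) (λ { refl → All.lookup x≢S y∈S refl })))

  filterᵇ-nor : ∀ (p q : A → Bool) L →
                filterᵇ (λ z → not (p z ∨ q z)) L ≡ filterᵇ (not ∘ p) (filterᵇ (not ∘ q) L)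
  filterᵇ-nor p q []      = refl
  filterᵇ-nor p q (y ∷ L) with q y
  ... | true  with p y
  ...   | true  = filterᵇ-nor p q L
  ...   | false = filterᵇ-nor p q L
  filterᵇ-nor p q (y ∷ L) | false with p y
  ...   | true  = filterᵇ-nor p q L
  ...   | false = cong (y ∷_) (filterᵇ-nor p q L)

  module _ (f : A → ℕ) (p : A → Bool) where
    private
      kept dropped : List A → ℕ
      kept    L = sum (map f (filterᵇ p L))
      dropped L = sum (map f (filterᵇ (not ∘ p) L))

    sum-filterᵇ-partition : ∀ L →
      sum (map f (filterᵇ p L)) + sum (map f (filterᵇ (not ∘ p) L)) ≡ sum (map f L)
    sum-filterᵇ-partition []      = refl
    sum-filterᵇ-partition (x ∷ L) with p x
    ... | true  = trans (ℕ.+-assoc (f x) (kept L) (dropped L)) (cong (f x +_) (sum-filterᵇ-partition L))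
    ... | false = trans (x∙yz≈y∙xz (kept L) (f x) (dropped L)) (cong (f x +_) (sum-filterᵇ-partition L))

module Reachability {X : Set} where

  Step : List (X → X) → X → X → Set
  Step G x y = Any (λ g → g x ≡ y) G

  Reach : List (X → X) → X → X → Set
  Reach G = Star (Step G)

  Involutions : List (X → X) → Set
  Involutions = All (Involutive _≡_)

  Step-sym : ∀ {G x y} → Involutions G → Step G x y → Step G y x
  Step-sym (inv ∷ _)   (here refl) = here (inv _)
  Step-sym (_ ∷ invol) (there s)   = there (Step-sym invol s)

  Reach-sym : ∀ {G x y} → Involutions G → Reach G x y → Reach G y x
  Reach-sym invol = Star.reverse (Step-sym invol)

  Conjugate : (X → X) → List (X → X) → List (X → X) → Set
  Conjugate φ = Pointwise (λ g h → ∀ x → φ (g x) ≡ h (φ x))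

  module _ (φ ψ : X → X) (ψ∘φ : ∀ x → ψ (φ x) ≡ x) (φ∘ψ : ∀ x → φ (ψ x) ≡ x) where

    Reach-conjugate : ∀ {G₁ G₂ x y} → Conjugate φ G₁ G₂ → Reach G₁ x y ⇔ Reach G₂ (φ x) (φ y)
    Reach-conjugate {G₁} {G₂} {x} {y} conj =
      mk⇔ (Star.gmap φ (forth conj))
          (subst₂ (Reach G₁) (ψ∘φ x) (ψ∘φ y) ∘ Star.gmap ψ (back conj))
      where
      forth : ∀ {G₁ G₂ x y} → Conjugate φ G₁ G₂ → Step G₁ x y → Step G₂ (φ x) (φ y)
      forth (g~h ∷ _)  (here refl) = here (sym (g~h _))
      forth (_ ∷ conj) (there s)   = there (forth conj s)

      back : ∀ {G₁ G₂ u w} → Conjugate φ G₁ G₂ → Step G₂ u w → Step G₁ (ψ u) (ψ w)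
      back {g ∷ _} {h ∷ _} {u} (g~h ∷ _) (here refl) = here (begin
        g (ψ u)           ≡⟨ sym (ψ∘φ (g (ψ u))) ⟩
        ψ (φ (g (ψ u)))   ≡⟨ cong ψ (g~h (ψ u)) ⟩
        ψ (h (φ (ψ u)))   ≡⟨ cong (ψ ∘ h) (φ∘ψ u) ⟩
        ψ (h u)           ∎)
        where open ≡-Reasoning
      back (_ ∷ conj) (there s) = there (back conj s)

module Classes {X : Set} where

  -- The elements of L with no r-related element after them; for an
  -- equivalence r, the number of r-classes meeting L.
  classes : (X → X → Bool) → List X → ℕ
  classes r []      = 0
  classes r (x ∷ L) = if any (r x) L then classes r L else suc (classes r L)

  any-intro : ∀ {p : X → Bool} {L y} → y ∈ L → T (p y) → T (any p L)
  any-intro y∈L py = any⁺ _ (lose y∈L py)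

  any-elim : ∀ {p : X → Bool} {L} → T (any p L) → ∃[ y ] y ∈ L × T (p y)
  any-elim {p} {L} t = find (any⁻ p L t)

  any-mono : ∀ {p q : X → Bool} {L} → (∀ {y} → T (p y) → T (q y)) → T (any p L) → T (any q L)
  any-mono {p} {q} {L} p⇒q t = let y , y∈L , py = any-elim {p} {L} t in any-intro {q} y∈L (p⇒q py)

  module _ {r : X → X → Bool} {x : X} {L : List X} where

    classes-∷-old : T (any (r x) L) → classes r (x ∷ L) ≡ classes r L
    classes-∷-old t with any (r x) L
    ... | true = refl

    classes-∷-new : ¬ T (any (r x) L) → classes r (x ∷ L) ≡ suc (classes r L)
    classes-∷-new ¬t with any (r x) L
    ... | true  = ⊥-elim (¬t _)
    ... | false = refl

    classes-≤-∷ : classes r L ≤ classes r (x ∷ L)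
    classes-≤-∷ with any (r x) L
    ... | true  = ℕ.≤-refl
    ... | false = ℕ.n≤1+n _

  classes-pos : ∀ {r y L} → y ∈ L → 1 ≤ classes r L
  classes-pos {r} {L = x ∷ L} _ = go x L
    where
    go : ∀ x L → 1 ≤ classes r (x ∷ L)
    go x []      = s≤s z≤n
    go x (z ∷ L) with any (r x) (z ∷ L)
    ... | true  = go z L
    ... | false = s≤s z≤n

  classes-≤-length : ∀ r L → classes r L ≤ length L
  classes-≤-length r []      = z≤n
  classes-≤-length r (x ∷ L) with any (r x) L
  ... | true  = ℕ.m≤n⇒m≤1+n (classes-≤-length r L)
  ... | false = s≤s (classes-≤-length r L)

  classes-antitone : ∀ {r s} → (∀ {x y} → T (r x y) → T (s x y)) → ∀ L → classes s L ≤ classes r L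
  classes-antitone r⇒s []      = z≤n
  classes-antitone {r} {s} r⇒s (x ∷ L) with any (r x) L in old | any (s x) L in old′
  ... | true  | true  = classes-antitone r⇒s L
  ... | true  | false = ⊥-elim (subst T old′ (any-mono {r x} {s x} {L} r⇒s (subst T (sym old) _)))
  ... | false | true  = ℕ.m≤n⇒m≤1+n (classes-antitone r⇒s L)
  ... | false | false = s≤s (classes-antitone r⇒s L)

  classes-map : ∀ r (f : X → X) L → classes (λ x y → r (f x) (f y)) L ≡ classes r (map f L)
  classes-map r f []      = refl
  classes-map r f (x ∷ L) rewrite classes-map r f L | map-∘ {g = r (f x)} {f = f} L = refl

  merge : (X → X → Bool) → List X → X → X → Bool
  merge r P x y = r x y ∨ (any (r x) P ∧ any (r y) P)

  module _ {r : X → X → Bool} (eqv : IsEquivalence (λ x y → T (r x y))) where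
    open IsEquivalence eqv renaming (refl to r-refl; sym to r-sym; trans to r-trans)

    private
      true⇒T : ∀ {b} → b ≡ true → T b
      true⇒T = Equivalence.from T-≡

    any-filter-unrelated : ∀ {x y} L → ¬ T (r x y) →
                           any (r y) (filterᵇ (not ∘ r x) L) ≡ any (r y) L
    any-filter-unrelated []      _    = refl
    any-filter-unrelated {x} {y} (z ∷ L) ¬rxy with r x z in rxz
    ... | false rewrite any-filter-unrelated L ¬rxy = refl
    ... | true with r y z in ryz
    ...   | true  = ⊥-elim (¬rxy (r-trans (true⇒T rxz) (r-sym (true⇒T ryz))))
    ...   | false = any-filter-unrelated L ¬rxy

    filter-unrelated : ∀ {x} L → ¬ T (any (r x) L) → filterᵇ (not ∘ r x) L ≡ L
    filter-unrelated []      _  = refl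
    filter-unrelated {x} (z ∷ L) ¬t with r x z
    ... | true  = ⊥-elim (¬t _)
    ... | false = cong (z ∷_) (filter-unrelated L ¬t)

    classes-remove : ∀ {x} L → T (any (r x) L) → classes r L ≡ suc (classes r (filterᵇ (not ∘ r x) L))
    classes-remove {x} (y ∷ L) t with r x y in rxy
    ... | true with any (r y) L in ry
    ...   | true  = classes-remove L (any-mono {r y} {r x} {L} (r-trans (true⇒T rxy)) (true⇒T ry))
    ...   | false = cong (suc ∘ classes r) (sym (filter-unrelated L
                      (subst T ry ∘ any-mono {r x} {r y} {L} (r-trans (r-sym (true⇒T rxy))))))
    classes-remove {x} (y ∷ L) t | false with any (r y) L in ry
    ...   | true  = trans (classes-remove L t) (cong suc (sym (classes-∷-old {r} {y} {filterᵇ (not ∘ r x) L}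
                      (subst T (sym (trans (any-filter-unrelated L (subst T rxy)) ry)) _))))
    ...   | false = cong suc (trans (classes-remove L t) (sym (classes-∷-new {r} {y} {filterᵇ (not ∘ r x) L}
                      (subst T (trans (any-filter-unrelated L (subst T rxy)) ry)))))

    classes-∷ : ∀ x L → classes r (x ∷ L) ≡ suc (classes r (filterᵇ (not ∘ r x) L))
    classes-∷ x L = trans (classes-remove (x ∷ L) (any-intro {r x} {x ∷ L} (here refl) r-refl))
                          (cong (suc ∘ classes r)
                                (filter-reject (T? ∘ (not ∘ r x)) (not-r-refl (r x x) r-refl)))
      where
      not-r-refl : ∀ b → T b → ¬ T (not b)
      not-r-refl true _ ()

    classes-cover : ∀ L L′ → (∀ {z} → z ∈ L → T (any (r z) L′)) → classes r L ≤ classes r L′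
    classes-cover []      _  _     = z≤n
    classes-cover (x ∷ L) L′ cover with any (r x) L in rx
    ... | true  = classes-cover L L′ (cover ∘ there)
    ... | false rewrite classes-remove L′ (cover (here refl)) =
      s≤s (classes-cover L (filterᵇ (not ∘ r x) L′) cover′)
      where
      cover′ : ∀ {z} → z ∈ L → T (any (r z) (filterᵇ (not ∘ r x) L′))
      cover′ {z} z∈L with any-elim {r z} {L′} (cover (there z∈L))
      ... | w , w∈L′ , rzw = any-intro {r z} (∈-filter⁺ (T? ∘ (not ∘ r x)) w∈L′ ¬rxw) rzw
        where
        ¬rxw : T (not (r x w))
        ¬rxw with r x w in rxw
        ... | false = _
        ... | true  = subst T rx (any-intro {r x} z∈L (r-trans (true⇒T rxw) (r-sym rzw)))

    module _ (P : List X) where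

      merge⇒ : ∀ {x y} → T (merge r P x y) → T (r x y) ⊎ (T (any (r x) P) × T (any (r y) P))
      merge⇒ {x} {y} = map₂ (Equivalence.to (T-∧ {any (r x) P})) ∘ Equivalence.to (T-∨ {r x y})

      ⇒merge : ∀ {x y} → T (r x y) ⊎ (T (any (r x) P) × T (any (r y) P)) → T (merge r P x y)
      ⇒merge {x} {y} = Equivalence.from (T-∨ {r x y}) ∘ map₂ (Equivalence.from (T-∧ {any (r x) P}))

      merge-trans : ∀ {x y z} → T (merge r P x y) → T (merge r P y z) → T (merge r P x z)
      merge-trans {x} {y} {z} m₁ m₂ with merge⇒ m₁ | merge⇒ m₂
      ... | inj₁ rxy       | inj₁ ryz       = ⇒merge (inj₁ (r-trans rxy ryz))
      ... | inj₁ rxy       | inj₂ (ty , tz) =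
        ⇒merge (inj₂ (any-mono {r y} {r x} {P} (r-trans rxy) ty , tz))
      ... | inj₂ (tx , ty) | inj₁ ryz       =
        ⇒merge (inj₂ (tx , any-mono {r y} {r z} {P} (r-trans (r-sym ryz)) ty))
      ... | inj₂ (tx , _)  | inj₂ (_ , tz)  = ⇒merge (inj₂ (tx , tz))

      touched : List X → List X
      touched = filterᵇ (λ z → any (r z) P)

      private
        touched-mono : ∀ x L → classes r (touched L) ≤ classes r (touched (x ∷ L))
        touched-mono x L with any (r x) P
        ... | true  = classes-≤-∷ {r} {x} {touched L}
        ... | false = ℕ.≤-refl

        pred-suc : ∀ {n} → 1 ≤ n → suc (n ∸ 1) ≡ n
        pred-suc (s≤s z≤n) = refl

      -- Only classes meeting P get joined, and joining k classes loses k − 1.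
      classes-merge-touched : ∀ L → classes r L ≤ classes (merge r P) L + (classes r (touched L) ∸ 1)
      classes-merge-touched []      = z≤n
      classes-merge-touched (x ∷ L) with any (r x) L in rx | any (merge r P x) L in mx
      ... | true  | true  =
        ℕ.≤-trans (classes-merge-touched L) (ℕ.+-monoʳ-≤ _ (ℕ.∸-monoˡ-≤ 1 (touched-mono x L)))
      ... | true  | false =
        ⊥-elim (subst T mx (any-mono {r x} {merge r P x} {L} (⇒merge ∘ inj₁) (true⇒T rx)))
      ... | false | false =
        s≤s (ℕ.≤-trans (classes-merge-touched L) (ℕ.+-monoʳ-≤ _ (ℕ.∸-monoˡ-≤ 1 (touched-mono x L))))
      ... | false | true  with any-elim {merge r P x} {L} (true⇒T mx)
      ...   | y , y∈L , mxy with merge⇒ mxy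
      ...     | inj₁ rxy = ⊥-elim (subst T rx (any-intro {r x} y∈L rxy))
      ...     | inj₂ (tx , ty) = begin
        suc (classes r L)                                  ≤⟨ s≤s (classes-merge-touched L) ⟩
        suc (classes M L + (classes r (touched L) ∸ 1))    ≡⟨ sym (ℕ.+-suc _ _) ⟩
        classes M L + suc (classes r (touched L) ∸ 1)      ≡⟨ cong (classes M L +_) (pred-suc y-touched) ⟩
        classes M L + classes r (touched L)                ≡⟨ cong (λ n → classes M L + (n ∸ 1)) x-new ⟨
        classes M L + (classes r (touched (x ∷ L)) ∸ 1)    ∎
        where
        open ℕ.≤-Reasoning
        M : X → X → Bool
        M = merge r P
        y-touched : 1 ≤ classes r (touched L)
        y-touched = classes-pos (∈-filter⁺ (λ z → T? (any (r z) P)) y∈L ty)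
        x-unrelated : ¬ T (any (r x) (touched L))
        x-unrelated t with any-elim {r x} {touched L} t
        ... | z , z∈ , rxz =
          subst T rx (any-intro {r x} {L} (proj₁ (∈-filter⁻ (λ z → T? (any (r z) P)) z∈)) rxz)
        x-new : classes r (touched (x ∷ L)) ≡ suc (classes r (touched L))
        x-new = trans (cong (classes r) (filter-accept (λ z → T? (any (r z) P)) tx))
                      (classes-∷-new {r} {x} {touched L} x-unrelated)

      classes-merge : ∀ L → classes r L ≤ classes (merge r P) L + (length P ∸ 1)
      classes-merge L =
        ℕ.≤-trans (classes-merge-touched L) (ℕ.+-monoʳ-≤ _ (ℕ.∸-monoˡ-≤ 1 (ℕ.≤-trans
          (classes-cover (touched L) P (proj₂ ∘ ∈-filter⁻ (λ z → T? (any (r z) P)) {xs = L}))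
          (classes-≤-length r P))))

    classes-same-elements : ∀ L L′ → (∀ {z} → z ∈ L → z ∈ L′) → (∀ {z} → z ∈ L′ → z ∈ L) →
                            classes r L ≡ classes r L′
    classes-same-elements L L′ L⊆L′ L′⊆L = ℕ.≤-antisym
      (classes-cover L L′ (λ {z} z∈L → any-intro {r z} (L⊆L′ z∈L) r-refl))
      (classes-cover L′ L (λ {z} z∈L′ → any-intro {r z} (L′⊆L z∈L′) r-refl))

  classes-⇔ : ∀ {r s} → (∀ {x y} → T (r x y) ⇔ T (s x y)) → ∀ L → classes r L ≡ classes s L
  classes-⇔ r⇔s L = ℕ.≤-antisym (classes-antitone (Equivalence.from r⇔s) L)
                                (classes-antitone (Equivalence.to r⇔s) L)

module OrbitClosure {X : Set} (_≟_ : DecidableEquality X) where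
  open Orbits _≟_
  open Reachability

  member⇒∈ : ∀ {x} S → T (member x S) → x ∈ S
  member⇒∈ {x} (y ∷ S) t with x ≟ y
  ... | yes refl = here refl
  ... | no _     = there (member⇒∈ S t)

  ∈⇒member : ∀ {x S} → x ∈ S → T (member x S)
  ∈⇒member {x} {y ∷ S} x∈ with x ≟ y
  ... | yes _   = _
  ... | no x≢y = ∈⇒member (Any.tail x≢y x∈)

  insert-view : ∀ x S → (x ∈ S × insert x S ≡ S) ⊎ (x ∉ S × insert x S ≡ x ∷ S)
  insert-view x S with member x S in eq
  ... | true  = inj₁ (member⇒∈ S (subst T (sym eq) _) , refl)
  ... | false = inj₂ ((λ x∈S → subst T eq (∈⇒member x∈S)) , refl)

  module _ {S : List X} where

    ⊆-insertAll : ∀ {y} l → y ∈ S → y ∈ foldr insert S l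
    ⊆-insertAll []      y∈S = y∈S
    ⊆-insertAll (z ∷ l) y∈S with insert-view z (foldr insert S l)
    ... | inj₁ (_ , eq) rewrite eq = ⊆-insertAll l y∈S
    ... | inj₂ (_ , eq) rewrite eq = there (⊆-insertAll l y∈S)

    insertAll-⊇ : ∀ {y} l → y ∈ l → y ∈ foldr insert S l
    insertAll-⊇ (z ∷ l) y∈l with insert-view z (foldr insert S l) | y∈l
    ... | inj₁ (z∈ , eq) | here refl rewrite eq = z∈
    ... | inj₂ (_ , eq)  | here refl rewrite eq = here refl
    ... | inj₁ (_ , eq)  | there y∈ rewrite eq = insertAll-⊇ l y∈
    ... | inj₂ (_ , eq)  | there y∈ rewrite eq = there (insertAll-⊇ l y∈)

    ∈-insertAll⁻ : ∀ {y} l → y ∈ foldr insert S l → y ∈ S ⊎ y ∈ l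
    ∈-insertAll⁻ []      y∈ = inj₁ y∈
    ∈-insertAll⁻ (z ∷ l) y∈ with insert-view z (foldr insert S l)
    ... | inj₁ (_ , eq) rewrite eq = map₂ there (∈-insertAll⁻ l y∈)
    ... | inj₂ (_ , eq) rewrite eq with y∈
    ...   | here refl = inj₂ (here refl)
    ...   | there y∈′ = map₂ there (∈-insertAll⁻ l y∈′)

    insertAll-unique : ∀ l → Unique S → Unique (foldr insert S l)
    insertAll-unique []      u = u
    insertAll-unique (z ∷ l) u with insert-view z (foldr insert S l)
    ... | inj₁ (_ , eq)   rewrite eq = insertAll-unique l u
    ... | inj₂ (z∉ , eq) rewrite eq = ¬Any⇒All¬ _ z∉ ∷ insertAll-unique l u

    insertAll-grows : ∀ l → foldr insert S l ≡ S ⊎ length S < length (foldr insert S l)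
    insertAll-grows []      = inj₁ refl
    insertAll-grows (z ∷ l) with insert-view z (foldr insert S l) | insertAll-grows l
    ... | inj₁ (_ , eq) | ih rewrite eq = ih
    ... | inj₂ (_ , eq) | inj₁ fixed rewrite eq | fixed = inj₂ ℕ.≤-refl
    ... | inj₂ (_ , eq) | inj₂ grows rewrite eq = inj₂ (ℕ.m≤n⇒m≤1+n grows)

  images : List (X → X) → List X → List X
  images G S = concatMap (λ g → map g S) G

  ∈-images⁺ : ∀ {G S g z} → g ∈ G → z ∈ S → g z ∈ images G S
  ∈-images⁺ {g ∷ G} {S} (here refl) z∈S = ∈-++⁺ˡ (∈-map⁺ g z∈S)
  ∈-images⁺ {h ∷ G} {S} (there g∈G) z∈S = ∈-++⁺ʳ (map h S) (∈-images⁺ g∈G z∈S)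

  ∈-images⁻ : ∀ {G S y} → y ∈ images G S → ∃[ z ] z ∈ S × Step G z y
  ∈-images⁻ {g ∷ G} {S} y∈ with ∈-++⁻ (map g S) y∈
  ... | inj₁ y∈gS with ∈-map⁻ g y∈gS
  ...   | z , z∈S , refl = z , z∈S , here refl
  ∈-images⁻ {g ∷ G} {S} y∈ | inj₂ y∈G with ∈-images⁻ y∈G
  ...   | z , z∈S , s = z , z∈S , there s

  Closed : List (X → X) → List X → Set
  Closed G S = ∀ {g y} → g ∈ G → y ∈ S → g y ∈ S

  Reach-closed : ∀ {G S x y} → Closed G S → x ∈ S → Reach G x y → y ∈ S
  Reach-closed closed x∈S ε       = x∈S
  Reach-closed closed x∈S (s ◅ r) = Reach-closed closed (Step-closed closed s x∈S) r
    where
    Step-closed : ∀ {G S x y} → Closed G S → Step G x y → x ∈ S → y ∈ S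
    Step-closed closed (here refl) x∈S = closed (here refl) x∈S
    Step-closed closed (there s)   x∈S = Step-closed (closed ∘ there) s x∈S

  fixed⇒closed : ∀ {G S} → step G S ≡ S → Closed G S
  fixed⇒closed {G} {S} fixed g∈G y∈S =
    subst (_ ∈_) fixed (insertAll-⊇ (images G S) (∈-images⁺ g∈G y∈S))

  closure-fixed : ∀ n {G S} → step G S ≡ S → closure n G S ≡ S
  closure-fixed zero    fixed = refl
  closure-fixed (suc n) fixed rewrite fixed = closure-fixed n fixed

  ⊆-closure : ∀ n {G S y} → y ∈ S → y ∈ closure n G S
  ⊆-closure zero    y∈S = y∈S
  ⊆-closure (suc n) {G} {S} y∈S = ⊆-closure n (⊆-insertAll (images G S) y∈S)

  closure-sound : ∀ n {G S y} → y ∈ closure n G S → ∃[ z ] z ∈ S × Reach G z y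
  closure-sound zero    y∈ = _ , y∈ , ε
  closure-sound (suc n) {G} {S} y∈ with closure-sound n y∈
  ... | z , z∈ , r with ∈-insertAll⁻ (images G S) z∈
  ...   | inj₁ z∈S = z , z∈S , r
  ...   | inj₂ z∈images with ∈-images⁻ z∈images
  ...     | w , w∈S , s = w , w∈S , s ◅ r

  member-++ : ∀ z A B → member z (A ++ B) ≡ member z A ∨ member z B
  member-++ z []      B = refl
  member-++ z (y ∷ A) B with z ≟ y
  ... | yes _ = refl
  ... | no _  = member-++ z A B

  -- The counting loop of countOrbits is local to a where block; the
  -- with-abstraction below lets unification name it.
  mutual
    loop : List X → List (X → X) → List X → List X → ℕ
    loop = _

    private
      countOrbits-∷ : ∀ x L G →
        countOrbits (x ∷ L) G ≡ suc (loop (x ∷ L) G (orbit (length (x ∷ L)) G x ++ []) L)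
      countOrbits-∷ x L G with orbit (length (x ∷ L)) G x ++ []
      ... | seen with x ∷ L
      ... | xs = refl

  countOrbits≡loop : ∀ xs G → countOrbits xs G ≡ loop xs G [] xs
  countOrbits≡loop []      G = refl
  countOrbits≡loop (x ∷ L) G = countOrbits-∷ x L G

  countOrbits-empty⊎positive : ∀ L → (∀ G → countOrbits L G ≡ 0) ⊎ (∀ G → 1 ≤ countOrbits L G)
  countOrbits-empty⊎positive []      = inj₁ (λ _ → refl)
  countOrbits-empty⊎positive (_ ∷ _) = inj₂ (λ _ → s≤s z≤n)

  module Enumerated (xs : List X) (complete : ∀ x → x ∈ xs) where

    closure-closed : ∀ n {G S} → Unique S → length xs < n + length S → Closed G (closure n G S)
    closure-closed zero {S = S} u long =
      ⊥-elim (ℕ.<⇒≱ long (pigeonhole u (λ {y} _ → complete y)))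
    closure-closed (suc n) {G} {S} u long with insertAll-grows {S} (images G S)
    ... | inj₁ fixed =
      subst (Closed G) (sym (trans (cong (closure n G) fixed) (closure-fixed n fixed))) (fixed⇒closed fixed)
    ... | inj₂ grows =
      closure-closed n (insertAll-unique (images G S) u)
        (ℕ.<-≤-trans long (subst (_≤ n + length (step G S)) (ℕ.+-suc n (length S))
                                 (ℕ.+-monoʳ-≤ n grows)))

    orbit-closed : ∀ G x → Closed G (orbit (length xs) G x)
    orbit-closed G x =
      closure-closed (length xs) ([] ∷ []) (subst (length xs <_) (ℕ.+-comm 1 (length xs)) ℕ.≤-refl)

    Reach⇔∈orbit : ∀ {G x y} → Reach G x y ⇔ y ∈ orbit (length xs) G x
    Reach⇔∈orbit {G} {x} =
      mk⇔ (Reach-closed (orbit-closed G x) (⊆-closure (length xs) (here refl)))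
          (from-singleton ∘ closure-sound (length xs))
      where
      from-singleton : ∀ {y} → ∃[ z ] z ∈ x ∷ [] × Reach G z y → Reach G x y
      from-singleton (_ , here refl , r) = r

    open Classes

    reach? : List (X → X) → X → X → Bool
    reach? G x y = member y (orbit (length xs) G x)

    reach?⇒Reach : ∀ {G x y} → T (reach? G x y) → Reach G x y
    reach?⇒Reach {G} {x} {y} = Equivalence.from Reach⇔∈orbit ∘ member⇒∈ (orbit (length xs) G x)

    Reach⇒reach? : ∀ {G x y} → Reach G x y → T (reach? G x y)
    Reach⇒reach? = ∈⇒member ∘ Equivalence.to Reach⇔∈orbit

    reach?-isEquivalence : ∀ {G} → Involutions G → IsEquivalence (λ x y → T (reach? G x y))
    reach?-isEquivalence {G} invol = record
      { refl  = λ {x} → Reach⇒reach? {G} {x} ε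
      ; sym   = λ {x} {y} → Reach⇒reach? ∘ Reach-sym invol ∘ reach?⇒Reach {G} {x} {y}
      ; trans = λ {x} {y} {z} p q →
          Reach⇒reach? (reach?⇒Reach {G} {x} {y} p ◅◅ reach?⇒Reach {G} {y} {z} q)
      }

    module _ {G : List (X → X)} (invol : Involutions G) where
      private
        r : X → X → Bool
        r = reach? G
        eqv : IsEquivalence (λ x y → T (r x y))
        eqv = reach?-isEquivalence invol
        open IsEquivalence eqv using () renaming (trans to r-trans)

      loop≡classes : ∀ seen L → (∀ {z w} → T (member z seen) → T (r z w) → T (member w seen)) →
                     loop xs G seen L ≡ classes r (filterᵇ (λ z → not (member z seen)) L)
      loop≡classes seen []      closed = refl
      loop≡classes seen (x ∷ L) closed with member x seen
      ... | true  = loop≡classes seen L closed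
      ... | false = begin
        suc (loop xs G (O ++ seen) L)
          ≡⟨ cong suc (loop≡classes (O ++ seen) L closed′) ⟩
        suc (classes r (filterᵇ (λ z → not (member z (O ++ seen))) L))
          ≡⟨ cong (suc ∘ classes r) (filter-split L) ⟩
        suc (classes r (filterᵇ (not ∘ r x) (filterᵇ (λ z → not (member z seen)) L)))
          ≡⟨ sym (classes-∷ eqv x (filterᵇ (λ z → not (member z seen)) L)) ⟩
        classes r (x ∷ filterᵇ (λ z → not (member z seen)) L) ∎
        where
        open ≡-Reasoning
        O : List X
        O = orbit (length xs) G x

        closed′ : ∀ {z w} → T (member z (O ++ seen)) → T (r z w) → T (member w (O ++ seen))
        closed′ {z} {w} z∈ rzw with Equivalence.to (T-∨ {member z O}) (subst T (member-++ z O seen) z∈)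
        ... | inj₁ z∈O    = subst T (sym (member-++ w O seen))
                               (Equivalence.from (T-∨ {member w O}) (inj₁ (r-trans {x} {z} {w} z∈O rzw)))
        ... | inj₂ z∈seen = subst T (sym (member-++ w O seen))
                               (Equivalence.from (T-∨ {member w O}) (inj₂ (closed z∈seen rzw)))

        filter-split : ∀ L → filterᵇ (λ z → not (member z (O ++ seen))) L
                             ≡ filterᵇ (not ∘ r x) (filterᵇ (λ z → not (member z seen)) L)
        filter-split L = trans
          (filter-≐ (T? ∘ _) (T? ∘ _) ((λ {z} → subst T (cong not (member-++ z O seen))) ,
                                       (λ {z} → subst T (cong not (sym (member-++ z O seen))))) L)
          (filterᵇ-nor (r x) (λ z → member z seen) L)

      countOrbits≡classes : countOrbits xs G ≡ classes r xs
      countOrbits≡classes = begin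
        countOrbits xs G                                      ≡⟨ countOrbits≡loop xs G ⟩
        loop xs G [] xs                                       ≡⟨ loop≡classes [] xs (λ ()) ⟩
        classes r (filterᵇ (λ z → not (member z [])) xs)      ≡⟨ cong (classes r)
                                                                   (filter-all _ (All.universal _ xs)) ⟩
        classes r xs                                          ∎
        where open ≡-Reasoning

    countOrbits-antitone : ∀ {G₁ G₂} → Involutions G₁ → Involutions G₂ →
                           (∀ {x y} → Step G₂ x y → Reach G₁ x y) → countOrbits xs G₁ ≤ countOrbits xs G₂
    countOrbits-antitone {G₁} {G₂} invol₁ invol₂ step =
      subst₂ _≤_ (sym (countOrbits≡classes invol₁)) (sym (countOrbits≡classes invol₂))
        (classes-antitone (λ {x} {y} → Reach⇒reach? ∘ Star.kleisliStar id step ∘ reach?⇒Reach {G₂} {x} {y})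
                          xs)

    countOrbits-cong : ∀ {G₁ G₂} → Involutions G₁ → Involutions G₂ →
                       (∀ {x y} → Step G₁ x y → Reach G₂ x y) →
                       (∀ {x y} → Step G₂ x y → Reach G₁ x y) →
                       countOrbits xs G₁ ≡ countOrbits xs G₂
    countOrbits-cong invol₁ invol₂ step₁ step₂ =
      ℕ.≤-antisym (countOrbits-antitone invol₁ invol₂ step₂) (countOrbits-antitone invol₂ invol₁ step₁)

    countOrbits-conjugate : ∀ {G₁ G₂} (φ ψ : X → X) → (∀ x → ψ (φ x) ≡ x) → (∀ x → φ (ψ x) ≡ x) →
                            Involutions G₁ → Involutions G₂ → Conjugate φ G₁ G₂ →
                            countOrbits xs G₁ ≡ countOrbits xs G₂
    countOrbits-conjugate {G₁} {G₂} φ ψ ψ∘φ φ∘ψ invol₁ invol₂ conj = begin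
      countOrbits xs G₁                                   ≡⟨ countOrbits≡classes invol₁ ⟩
      classes (reach? G₁) xs                              ≡⟨ classes-⇔ reach-conj xs ⟩
      classes (λ x y → reach? G₂ (φ x) (φ y)) xs          ≡⟨ classes-map (reach? G₂) φ xs ⟩
      classes (reach? G₂) (map φ xs)                      ≡⟨ classes-same-elements eqv₂ (map φ xs) xs
                                                               (λ {z} _ → complete z) onto ⟩
      classes (reach? G₂) xs                              ≡⟨ countOrbits≡classes invol₂ ⟨
      countOrbits xs G₂                                   ∎
      where
      open ≡-Reasoning
      eqv₂ : IsEquivalence (λ x y → T (reach? G₂ x y))
      eqv₂ = reach?-isEquivalence invol₂
      reach-conj : ∀ {x y} → T (reach? G₁ x y) ⇔ T (reach? G₂ (φ x) (φ y))
      reach-conj {x} {y} = mk⇔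
        (Reach⇒reach? ∘ Equivalence.to conjugate ∘ reach?⇒Reach {G₁} {x} {y})
        (Reach⇒reach? ∘ Equivalence.from conjugate ∘ reach?⇒Reach {G₂} {φ x} {φ y})
        where conjugate = Reach-conjugate φ ψ ψ∘φ φ∘ψ conj
      onto : ∀ {z} → z ∈ xs → z ∈ map φ xs
      onto {z} _ = subst (_∈ map φ xs) (φ∘ψ z) (∈-map⁺ φ (complete (ψ z)))

    -- The new connections only join orbits meeting P, and at most length P
    -- orbits meet P.
    countOrbits-merge : ∀ {G₁ G₂} (P : List X) → Involutions G₁ → Involutions G₂ →
                        (∀ {x y} → Step G₁ x y →
                                   Reach G₂ x y ⊎ (Any (Reach G₂ x) P × Any (Reach G₂ y) P)) →
                        countOrbits xs G₂ ≤ countOrbits xs G₁ + (length P ∸ 1)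
    countOrbits-merge {G₁} {G₂} P invol₁ invol₂ step = begin
      countOrbits xs G₂                         ≡⟨ countOrbits≡classes invol₂ ⟩
      classes r₂ xs                             ≤⟨ classes-merge eqv₂ P xs ⟩
      classes (merge r₂ P) xs + (length P ∸ 1)  ≤⟨ ℕ.+-monoˡ-≤ _ (classes-antitone reach⇒merge xs) ⟩
      classes (reach? G₁) xs + (length P ∸ 1)   ≡⟨ cong (_+ (length P ∸ 1)) (countOrbits≡classes invol₁) ⟨
      countOrbits xs G₁ + (length P ∸ 1)        ∎
      where
      open ℕ.≤-Reasoning
      r₂ : X → X → Bool
      r₂ = reach? G₂
      eqv₂ : IsEquivalence (λ x y → T (r₂ x y))
      eqv₂ = reach?-isEquivalence invol₂
      touch : ∀ {x} → Any (Reach G₂ x) P → T (any (r₂ x) P)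
      touch = any⁺ _ ∘ Any.map Reach⇒reach?
      Step⇒merge : ∀ {x y} → Step G₁ x y → T (merge r₂ P x y)
      Step⇒merge s with step s
      ... | inj₁ r         = ⇒merge eqv₂ P (inj₁ (Reach⇒reach? r))
      ... | inj₂ (tx , ty) = ⇒merge eqv₂ P (inj₂ (touch tx , touch ty))
      reach⇒merge : ∀ {x y} → T (reach? G₁ x y) → T (merge r₂ P x y)
      reach⇒merge {x} {y} = Star.fold (λ x y → T (merge r₂ P x y))
        (λ s m → merge-trans eqv₂ P (Step⇒merge s) m) (⇒merge eqv₂ P (inj₁ (IsEquivalence.refl eqv₂)))
        ∘ reach?⇒Reach {G₁} {x} {y}

    countOrbits-swap : ∀ {f g} → Involutive _≡_ f → Involutive _≡_ g →
                       countOrbits xs (f ∷ g ∷ []) ≡ countOrbits xs (g ∷ f ∷ [])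
    countOrbits-swap f-invol g-invol =
      countOrbits-cong (f-invol ∷ g-invol ∷ []) (g-invol ∷ f-invol ∷ []) swap swap
      where
      swap : ∀ {f g x y} → Step (f ∷ g ∷ []) x y → Reach (g ∷ f ∷ []) x y
      swap (here eq)         = there (here eq) ◅ ε
      swap (there (here eq)) = here eq ◅ ε

cycSuc-fromℕ : ∀ n → cycSuc (fromℕ n) ≡ zero
cycSuc-fromℕ zero    = refl
cycSuc-fromℕ (suc n) with cycSuc (fromℕ n) | cycSuc-fromℕ n
... | .zero | refl = refl

cycSuc-inject₁ : ∀ {n} (i : Fin n) → cycSuc (inject₁ i) ≡ suc i
cycSuc-inject₁ {suc n}       zero    = refl
cycSuc-inject₁ {suc (suc n)} (suc i) with cycSuc (inject₁ i) | cycSuc-inject₁ i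
... | .(suc i) | refl = refl

cycSuc∘cycPred : ∀ {n} (i : Fin n) → cycSuc (cycPred i) ≡ i
cycSuc∘cycPred {suc n} zero    = cycSuc-fromℕ n
cycSuc∘cycPred {suc n} (suc i) = cycSuc-inject₁ i

cycPred∘cycSuc : ∀ {n} (i : Fin n) → cycPred (cycSuc i) ≡ i
cycPred∘cycSuc {suc zero}    zero    = refl
cycPred∘cycSuc {suc (suc n)} zero    = refl
cycPred∘cycSuc {suc (suc n)} (suc i) with cycSuc i | cycPred∘cycSuc i
... | zero  | eq = cong suc eq
... | suc _ | eq = cong suc eq

∅ full : ∀ {m} → EdgeSubset m
∅    _ = false
full _ = true

∁ : ∀ {m} → EdgeSubset m → EdgeSubset m
∁ A = not ∘ A

∉-filterᵇ-allFin : ∀ {m} (p : EdgeSubset m) e → e ∉ filterᵇ p (allFin m) → p e ≡ false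
∉-filterᵇ-allFin p e e∉ with p e in pe
... | false = refl
... | true  = ⊥-elim (e∉ (∈-filter⁺ (T? ∘ p) (∈-allFin e) (subst T (sym pe) _)))

module Flags {m : ℕ} {d : Fin m → ℕ} where

  allFlags-complete : ∀ x → x ∈ allFlags m d
  allFlags-complete ((e , i) , end) =
    ∈-concatMap⁺ _ (Any.map (λ { refl → ∈-concatMap⁺ _ (Any.map (λ { refl → both-ends end })
                                                                (∈-allFin i)) })
                            (∈-allFin e))
    where
    both-ends : ∀ end → ((e , i) , end) ∈ ((e , i) , tail) ∷ ((e , i) , head) ∷ []
    both-ends tail = here refl
    both-ends head = there (here refl)

  edge : Flag m d → Fin m
  edge ((e , _) , _) = e

  rs⟨_⟩ : EdgeSubset m → Flag m d → Flag m d
  rs⟨ A ⟩ x = if A (edge x) then re x else rs x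

  rs-involutive : Involutive _≡_ (rs {m} {d})
  rs-involutive (a , tail) = refl
  rs-involutive (a , head) = refl

  re-involutive : Involutive _≡_ (re {m} {d})
  re-involutive ((e , i) , tail) = cong (λ j → (e , j) , tail) (cycSuc∘cycPred i)
  re-involutive ((e , i) , head) = cong (λ j → (e , j) , head) (cycPred∘cycSuc i)

  rs⟨⟩-involutive : ∀ A → Involutive _≡_ rs⟨ A ⟩
  rs⟨⟩-involutive A ((e , i) , tail) with A e in eq
  ... | true  rewrite eq = re-involutive ((e , i) , tail)
  ... | false rewrite eq = refl
  rs⟨⟩-involutive A ((e , i) , head) with A e in eq
  ... | true  rewrite eq = re-involutive ((e , i) , head)
  ... | false rewrite eq = refl

  edge-rs⟨⟩ : ∀ A x → edge (rs⟨ A ⟩ x) ≡ edge x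
  edge-rs⟨⟩ A ((e , i) , tail) with A e
  ... | true  = refl
  ... | false = refl
  edge-rs⟨⟩ A ((e , i) , head) with A e
  ... | true  = refl
  ... | false = refl

  rs⟨⟩-cases : ∀ A x → (rs⟨ A ⟩ x ≡ re x × rs⟨ ∁ A ⟩ x ≡ rs x)
                     ⊎ (rs⟨ A ⟩ x ≡ rs x × rs⟨ ∁ A ⟩ x ≡ re x)
  rs⟨⟩-cases A x with A (edge x)
  ... | true  = inj₁ (refl , refl)
  ... | false = inj₂ (refl , refl)

  module _ (A : EdgeSubset m) where

    φ∘φ⁻¹ : ∀ (x : Flag m d) → φ A (φ⁻¹ A x) ≡ x
    φ∘φ⁻¹ ((e , i) , tail) with A e in eq
    ... | true  rewrite eq = cong (λ j → (e , j) , tail) (cycSuc∘cycPred i)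
    ... | false rewrite eq = refl
    φ∘φ⁻¹ ((e , i) , head) with A e in eq
    ... | true  rewrite eq = refl
    ... | false rewrite eq = refl

    φ⁻¹∘φ : ∀ (x : Flag m d) → φ⁻¹ A (φ A x) ≡ x
    φ⁻¹∘φ ((e , i) , tail) with A e in eq
    ... | true  rewrite eq = refl
    ... | false rewrite eq = refl
    φ⁻¹∘φ ((e , i) , head) with A e in eq
    ... | true  rewrite eq = cong (λ j → (e , j) , head) (cycPred∘cycSuc i)
    ... | false rewrite eq = refl

    φ-rs : ∀ (x : Flag m d) → φ A (rs x) ≡ rs⟨ A ⟩ (φ A x)
    φ-rs ((e , i) , tail) with A e in eq
    ... | true  rewrite eq = refl
    ... | false rewrite eq = refl
    φ-rs ((e , i) , head) with A e in eq
    ... | true  rewrite eq = cong (λ j → (e , j) , head) (sym (cycPred∘cycSuc i))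
    ... | false rewrite eq = refl

    φ-re : ∀ (x : Flag m d) → φ A (re x) ≡ rs⟨ ∁ A ⟩ (φ A x)
    φ-re ((e , i) , tail) with A e in eq
    ... | true  rewrite eq = cong (λ j → (e , j) , tail) (cycSuc∘cycPred i)
    ... | false rewrite eq = refl
    φ-re ((e , i) , head) with A e in eq
    ... | true  rewrite eq = refl
    ... | false rewrite eq = refl

eulerGenus-partialDual : ∀ H A → k# (partialDual H A) ≡ k# H →
                         v# (partialDual H A) + f# (partialDual H A) ≡ v# H + f# H →
                         eulerGenus (partialDual H A) ≡ eulerGenus H
eulerGenus-partialDual H A k≡ v+f≡ =
  cong₂ (λ a b → ℤ.+ a ℤ.- ℤ.+ b) (cong (λ k → 2 * k + d# H) k≡) (begin
    v# H^A + m H + f# H^A     ≡⟨ shuffle (v# H^A) (m H) (f# H^A) ⟩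
    m H + (v# H^A + f# H^A)   ≡⟨ cong (m H +_) v+f≡ ⟩
    m H + (v# H + f# H)       ≡⟨ shuffle (v# H) (m H) (f# H) ⟨
    v# H + m H + f# H         ∎)
  where
  open ≡-Reasoning
  H^A : RibbonHypermap
  H^A = partialDual H A
  shuffle : ∀ v e f → v + e + f ≡ e + (v + f)
  shuffle = solve-∀

foldr-sum≡0 : ∀ {A : Set} {f : A → ℕ} L → foldr (λ a n → f a + n) 0 L ≡ 0 →
              ∀ {a} → a ∈ L → f a ≡ 0
foldr-sum≡0 {f = f} (a ∷ L) sum≡0 (here refl) = ℕ.m+n≡0⇒m≡0 (f a) sum≡0
foldr-sum≡0 {f = f} (a ∷ L) sum≡0 (there a∈L) = foldr-sum≡0 L (ℕ.m+n≡0⇒n≡0 (f a) sum≡0) a∈L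

-- The zero-degree indicator summed by countZeroDeg is local to Defs; it is
-- reached as the f that unification picks for foldr-sum≡0.
no-zero-degree : ∀ m (d : Fin m → ℕ) → countZeroDeg m d ≡ 0 → ∀ e → 1 ≤ d e
no-zero-degree m d none e with d e | foldr-sum≡0 (allFin m) none (∈-allFin e)
... | zero  | ()
... | suc _ | _ = s≤s z≤n

foldr-degrees : ∀ {m} (d : Fin m → ℕ) → (∀ e → 1 ≤ d e) → ∀ L →
                foldr (λ e n → d e + n) 0 L ≡ length L + sum (map (λ e → d e ∸ 1) L)
foldr-degrees d positive []      = refl
foldr-degrees d positive (e ∷ L) with d e | positive e
... | suc k | _ = cong suc (trans (cong (k +_) (foldr-degrees d positive L)) (x∙yz≈y∙xz k (length L) _))

1≤m∧m+n≡1 : ∀ {m n} → 1 ≤ m → m + n ≡ 1 → m ≡ 1 × n ≡ 0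
1≤m∧m+n≡1 {suc zero} {zero} _ _ = refl , refl

-- cv, ck, cf count the vertex, component and face orbits of the arrow ends,
-- iso the isolated vertices, z the hyperedges of degree 0, D = d(H), e = e(H)
-- and N = Σₑ (d(e) − 1).
plane-bouquet-arithmetic : ∀ {cv ck cf iso z D e N} →
  (cv ≡ 0 × ck ≡ 0 × cf ≡ 0) ⊎ (1 ≤ cv × 1 ≤ ck) → cv + iso ≡ 1 → ck + iso + z ≡ 1 →
  (z ≡ 0 → D ≡ e + N) → 2 * 1 + D ≡ cv + iso + e + (cf + z) → cf ≡ cv + N
plane-bouquet-arithmetic {e = e} {N} (inj₁ (refl , refl , refl)) refl refl degrees genus with degrees refl
... | refl = ⊥-elim (ℕ.<-irrefl refl
               (subst (e <_) (trans (ℕ.suc-injective genus) (ℕ.+-identityʳ e)) (s≤s (ℕ.m≤m+n e N))))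
plane-bouquet-arithmetic {ck = ck} {cf} {e = e} {N} (inj₂ (1≤cv , 1≤ck)) v k degrees genus
  with 1≤m∧m+n≡1 1≤cv v
... | refl , refl with 1≤m∧m+n≡1 (ℕ.≤-trans 1≤ck (ℕ.m≤m+n ck 0)) k
...   | _ , refl with degrees refl
...     | refl = sym (trans (ℕ.+-cancelˡ-≡ e _ _ (trans (ℕ.+-suc e N) (ℕ.suc-injective genus)))
                            (ℕ.+-identityʳ cf))

module PartialDual (H : RibbonHypermap) (wf : WellFormed H) where
  open Flags {m H} {d H}
  open Reachability
  open Orbits (Flag-≟ {m H} {d H}) using (countOrbits)
  open OrbitClosure (Flag-≟ {m H} {d H})
  open Enumerated (allFlags (m H) (d H)) allFlags-complete

  private
    FL : Set
    FL = Flag (m H) (d H)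
    xs : List FL
    xs = allFlags (m H) (d H)

    rv-involutive : Involutive _≡_ (rv H)
    rv-involutive = proj₁ wf

    rv^ : EdgeSubset (m H) → FL → FL
    rv^ A = rv (partialDual H A)

    φ-rv^ : ∀ A x → φ A (rv^ A x) ≡ rv H (φ A x)
    φ-rv^ A x = φ∘φ⁻¹ A (rv H (φ A x))

    rv^-involutive : ∀ A → Involutive _≡_ (rv^ A)
    rv^-involutive A x = begin
      φ⁻¹ A (rv H (φ A (φ⁻¹ A (rv H (φ A x)))))  ≡⟨ cong (φ⁻¹ A ∘ rv H) (φ-rv^ A x) ⟩
      φ⁻¹ A (rv H (rv H (φ A x)))                ≡⟨ cong (φ⁻¹ A) (rv-involutive (φ A x)) ⟩
      φ⁻¹ A (φ A x)                              ≡⟨ φ⁻¹∘φ A x ⟩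
      x                                          ∎
      where open ≡-Reasoning

  ν : EdgeSubset (m H) → ℕ
  ν A = countOrbits xs (rs⟨ A ⟩ ∷ rv H ∷ [])

  v#-partialDual : ∀ A → v# (partialDual H A) ≡ ν A + iso H
  v#-partialDual A = cong (_+ iso H) (countOrbits-conjugate (φ A) (φ⁻¹ A) (φ⁻¹∘φ A) (φ∘φ⁻¹ A)
    (rs-involutive ∷ rv^-involutive A ∷ []) (rs⟨⟩-involutive A ∷ rv-involutive ∷ [])
    (φ-rs A ∷ φ-rv^ A ∷ []))

  f#-partialDual : ∀ A → f# (partialDual H A) ≡ ν (∁ A) + countZeroDeg (m H) (d H)
  f#-partialDual A = cong (_+ countZeroDeg (m H) (d H)) (trans
    (countOrbits-conjugate (φ A) (φ⁻¹ A) (φ⁻¹∘φ A) (φ∘φ⁻¹ A)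
      (rv^-involutive A ∷ re-involutive ∷ []) (rv-involutive ∷ rs⟨⟩-involutive (∁ A) ∷ [])
      (φ-rv^ A ∷ φ-re A ∷ []))
    (countOrbits-swap rv-involutive (rs⟨⟩-involutive (∁ A))))

  k#-partialDual : ∀ A → k# (partialDual H A) ≡ k# H
  k#-partialDual A = cong (λ n → n + iso H + countZeroDeg (m H) (d H)) (trans
    (countOrbits-conjugate (φ A) (φ⁻¹ A) (φ⁻¹∘φ A) (φ∘φ⁻¹ A)
      (rs-involutive ∷ rv^-involutive A ∷ re-involutive ∷ []) twisted-involutive
      (φ-rs A ∷ φ-rv^ A ∷ φ-re A ∷ []))
    (countOrbits-cong twisted-involutive (rs-involutive ∷ rv-involutive ∷ re-involutive ∷ []) forth back))
    where
    twisted-involutive : Involutions (rs⟨ A ⟩ ∷ rv H ∷ rs⟨ ∁ A ⟩ ∷ [])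
    twisted-involutive = rs⟨⟩-involutive A ∷ rv-involutive ∷ rs⟨⟩-involutive (∁ A) ∷ []

    forth : ∀ {x y} → Step (rs⟨ A ⟩ ∷ rv H ∷ rs⟨ ∁ A ⟩ ∷ []) x y →
                      Reach (rs ∷ rv H ∷ re ∷ []) x y
    forth {x} (here refl) with rs⟨⟩-cases A x
    ... | inj₁ (eq , _) = there (there (here (sym eq))) ◅ ε
    ... | inj₂ (eq , _) = here (sym eq) ◅ ε
    forth (there (here refl)) = there (here refl) ◅ ε
    forth {x} (there (there (here refl))) with rs⟨⟩-cases A x
    ... | inj₁ (_ , eq) = here (sym eq) ◅ ε
    ... | inj₂ (_ , eq) = there (there (here (sym eq))) ◅ ε

    back : ∀ {x y} → Step (rs ∷ rv H ∷ re ∷ []) x y →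
                     Reach (rs⟨ A ⟩ ∷ rv H ∷ rs⟨ ∁ A ⟩ ∷ []) x y
    back {x} (here refl) with rs⟨⟩-cases A x
    ... | inj₁ (_ , eq) = there (there (here eq)) ◅ ε
    ... | inj₂ (eq , _) = here eq ◅ ε
    back (there (here refl)) = there (here refl) ◅ ε
    back {x} (there (there (here refl))) with rs⟨⟩-cases A x
    ... | inj₁ (eq , _) = here eq ◅ ε
    ... | inj₂ (_ , eq) = there (there (here eq)) ◅ ε

  surplus : Fin (m H) → ℕ
  surplus e = d H e ∸ 1

  excess : EdgeSubset (m H) → ℕ
  excess A = sum (map surplus (filterᵇ A (allFin (m H))))

  totalExcess : ℕ
  totalExcess = sum (map surplus (allFin (m H)))

  excess-∁ : ∀ A → excess A + excess (∁ A) ≡ totalExcess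
  excess-∁ A = sum-filterᵇ-partition surplus A (allFin (m H))

  ν-switch : ∀ A A′ e → (∀ e′ → e′ ≢ e → A e′ ≡ A′ e′) → ν A′ ≤ ν A + surplus e
  ν-switch A A′ e agree = subst (λ n → ν A′ ≤ ν A + (n ∸ 1)) length-heads
    (countOrbits-merge heads (rs⟨⟩-involutive A ∷ rv-involutive ∷ [])
                             (rs⟨⟩-involutive A′ ∷ rv-involutive ∷ []) step)
    where
    G′ : List (FL → FL)
    G′ = rs⟨ A′ ⟩ ∷ rv H ∷ []

    heads : List FL
    heads = map (λ i → (e , i) , head) (allFin (d H e))

    length-heads : length heads ≡ d H e
    length-heads = trans (length-map _ (allFin (d H e))) (length-tabulate id)

    tail-to-head : ∀ i → rs⟨ A′ ⟩ ((e , i) , tail) ∈ heads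
    tail-to-head i with A′ e
    ... | true  = ∈-map⁺ _ (∈-allFin (cycPred i))
    ... | false = ∈-map⁺ _ (∈-allFin i)

    touches : ∀ w → edge w ≡ e → Any (Reach G′ w) heads
    touches ((.e , i) , head) refl = lose (∈-map⁺ _ (∈-allFin i)) ε
    touches ((.e , i) , tail) refl = lose (tail-to-head i) (here refl ◅ ε)

    step : ∀ {x y} → Step (rs⟨ A ⟩ ∷ rv H ∷ []) x y →
                     Reach G′ x y ⊎ (Any (Reach G′ x) heads × Any (Reach G′ y) heads)
    step {x} (here refl) with edge x Fin.≟ e
    ... | yes on-e  = inj₂ (touches x on-e , touches (rs⟨ A ⟩ x) (trans (edge-rs⟨⟩ A x) on-e))
    ... | no  off-e =
      inj₁ (here (cong (λ b → if b then re x else rs x) (sym (agree (edge x) off-e))) ◅ ε)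
    step (there (here refl)) = inj₁ (there (here refl) ◅ ε)

  ν-≤ : ∀ L A B → (∀ e → e ∉ L → A e ≡ B e) → ν A ≤ ν B + sum (map surplus L)
  ν-≤ [] A B agree = subst (ν A ≤_) (sym (ℕ.+-identityʳ (ν B)))
    (countOrbits-antitone (rs⟨⟩-involutive A ∷ rv-involutive ∷ [])
                          (rs⟨⟩-involutive B ∷ rv-involutive ∷ []) step)
    where
    step : ∀ {x y} → Step (rs⟨ B ⟩ ∷ rv H ∷ []) x y → Reach (rs⟨ A ⟩ ∷ rv H ∷ []) x y
    step {x} (here refl) = here (cong (λ b → if b then re x else rs x) (agree (edge x) λ ())) ◅ ε
    step (there (here refl)) = there (here refl) ◅ ε
  ν-≤ (e ∷ L) A B agree = begin
    ν A                                      ≤⟨ ν-switch A′ A e (λ e′ → updateAt-minimal e′ e A) ⟩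
    ν A′ + surplus e                         ≤⟨ ℕ.+-monoˡ-≤ (surplus e) (ν-≤ L A′ B agree′) ⟩
    ν B + sum (map surplus L) + surplus e    ≡⟨ shuffle (ν B) _ (surplus e) ⟩
    ν B + (surplus e + sum (map surplus L))  ∎
    where
    open ℕ.≤-Reasoning
    A′ : EdgeSubset (m H)
    A′ = updateAt A e (λ _ → B e)
    agree′ : ∀ e′ → e′ ∉ L → A′ e′ ≡ B e′
    agree′ e′ e′∉L with e′ Fin.≟ e
    ... | yes refl  = updateAt-updates e A
    ... | no  e′≢e = trans (updateAt-minimal e′ e A e′≢e)
                           (agree e′ λ { (here e′≡e)  → e′≢e e′≡e
                                       ; (there e′∈L) → e′∉L e′∈L })
    shuffle : ∀ a b c → a + b + c ≡ a + (c + b)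
    shuffle = solve-∀

  module _ (extremal : ν full ≡ ν ∅ + totalExcess) where

    ν-exact : ∀ A → ν A ≡ ν ∅ + excess A
    ν-exact A = ℕ.≤-antisym upper (ℕ.+-cancelʳ-≤ (excess (∁ A)) _ _ lower)
      where
      upper : ν A ≤ ν ∅ + excess A
      upper = ν-≤ (filterᵇ A (allFin (m H))) A ∅ (∉-filterᵇ-allFin A)

      lower : ν ∅ + excess A + excess (∁ A) ≤ ν A + excess (∁ A)
      lower = begin
        ν ∅ + excess A + excess (∁ A)    ≡⟨ ℕ.+-assoc (ν ∅) (excess A) (excess (∁ A)) ⟩
        ν ∅ + (excess A + excess (∁ A))  ≡⟨ cong (ν ∅ +_) (excess-∁ A) ⟩
        ν ∅ + totalExcess                ≡⟨ extremal ⟨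
        ν full                           ≤⟨ ν-≤ (filterᵇ (∁ A) (allFin (m H))) full A
                                              (λ e → sym ∘ not-injective ∘ ∉-filterᵇ-allFin (∁ A) e) ⟩
        ν A + excess (∁ A)               ∎
        where open ℕ.≤-Reasoning

    ν-complementary : ∀ A → ν A + ν (∁ A) ≡ ν ∅ + ν full
    ν-complementary A = begin
      ν A + ν (∁ A)                            ≡⟨ cong₂ _+_ (ν-exact A) (ν-exact (∁ A)) ⟩
      (ν ∅ + excess A) + (ν ∅ + excess (∁ A))  ≡⟨ shuffle (ν ∅) (excess A) (excess (∁ A)) ⟩
      ν ∅ + (ν ∅ + (excess A + excess (∁ A)))  ≡⟨ cong (λ n → ν ∅ + (ν ∅ + n)) (excess-∁ A) ⟩
      ν ∅ + (ν ∅ + totalExcess)                ≡⟨ cong (ν ∅ +_) extremal ⟨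
      ν ∅ + ν full                             ∎
      where
      open ≡-Reasoning
      shuffle : ∀ a x y → (a + x) + (a + y) ≡ a + (a + (x + y))
      shuffle = solve-∀

    eulerGenus-invariant : ∀ A → eulerGenus (partialDual H A) ≡ eulerGenus H
    eulerGenus-invariant A = eulerGenus-partialDual H A (k#-partialDual A) (begin
      v# (partialDual H A) + f# (partialDual H A)  ≡⟨ cong₂ _+_ (v#-partialDual A) (f#-partialDual A) ⟩
      (ν A + iso H) + (ν (∁ A) + z)                ≡⟨ shuffle (ν A) (iso H) (ν (∁ A)) z ⟩
      (ν A + ν (∁ A)) + (iso H + z)                ≡⟨ cong (_+ (iso H + z)) (ν-complementary A) ⟩
      (ν ∅ + ν full) + (iso H + z)                 ≡⟨ shuffle (ν ∅) (ν full) (iso H) z ⟩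
      (ν ∅ + iso H) + (ν full + z)                 ≡⟨ cong (λ n → ν ∅ + iso H + (n + z))
                                                           (countOrbits-swap re-involutive rv-involutive) ⟩
      v# H + f# H                                  ∎)
      where
      open ≡-Reasoning
      z : ℕ
      z = countZeroDeg (m H) (d H)
      shuffle : ∀ a b c e → (a + b) + (c + e) ≡ (a + c) + (b + e)
      shuffle = solve-∀

  plane-bouquet-extremal : IsHyperBouquet H → IsPlane H → ν full ≡ ν ∅ + totalExcess
  plane-bouquet-extremal bouquet (connected , plane) = trans
    (countOrbits-swap re-involutive rv-involutive)
    (plane-bouquet-arithmetic counts bouquet connected degrees genus)
    where
    counts : (ν ∅ ≡ 0 × countOrbits xs (rs ∷ rv H ∷ re ∷ []) ≡ 0 × countOrbits xs (rv H ∷ re ∷ []) ≡ 0)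
           ⊎ (1 ≤ ν ∅ × 1 ≤ countOrbits xs (rs ∷ rv H ∷ re ∷ []))
    counts with countOrbits-empty⊎positive xs
    ... | inj₁ none     = inj₁ (none _ , none _ , none _)
    ... | inj₂ positive = inj₂ (positive _ , positive _)

    degrees : countZeroDeg (m H) (d H) ≡ 0 → d# H ≡ m H + totalExcess
    degrees none = trans (foldr-degrees (d H) (no-zero-degree (m H) (d H) none) (allFin (m H)))
                         (cong (_+ totalExcess) (length-tabulate id))

    genus : 2 * 1 + d# H ≡ v# H + m H + f# H
    genus = trans (cong (λ k → 2 * k + d# H) (sym connected))
                  (ℤ.+-injective (ℤ.i-j≡0⇒i≡j _ _ plane))

count-const : ∀ {Y : Set} (p : Y → Bool) b → (∀ y → p y ≡ b) →
              ∀ L → count p L ≡ (if b then length L else 0)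
count-const p true  p≡b []      = refl
count-const p false p≡b []      = refl
count-const p b     p≡b (y ∷ L) rewrite p≡b y with b
... | true  = cong suc (count-const p true p≡b L)
... | false = count-const p false p≡b L

length-allSubsets : ∀ m → length (allSubsets m) ≡ 2 ^ m
length-allSubsets zero    = refl
length-allSubsets (suc m) = trans (length-pairs (allSubsets m)) (cong (2 *_) (length-allSubsets m))
  where
  length-pairs : ∀ {Y Z : Set} {f g : Y → Z} L →
                 length (concatMap (λ y → f y ∷ g y ∷ []) L) ≡ 2 * length L
  length-pairs []      = refl
  length-pairs (y ∷ L) = trans (cong (2 +_) (length-pairs L)) (sym (ℕ.*-suc 2 (length L)))

partialDualPoly-allPlane : ∀ H → (∀ A → eulerGenus (partialDual H A) ≡ ℤ.+ 0) →
                           ∀ k → partialDualPoly H k ≡ constPoly (2 ^ e# H) k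
partialDualPoly-allPlane H allPlane k = trans
  (count-const _ (does (ℤ.+ 0 ℤ.≟ ℤ.+ k)) (λ A → cong (λ g → does (g ℤ.≟ ℤ.+ k)) (allPlane A))
               (allSubsets (m H)))
  (by-degree k)
  where
  by-degree : ∀ k → (if does (ℤ.+ 0 ℤ.≟ ℤ.+ k) then length (allSubsets (m H)) else 0)
                    ≡ constPoly (2 ^ e# H) k
  by-degree zero    = length-allSubsets (m H)
  by-degree (suc k) = refl

proposition4p10 : (B : RibbonHypermap) → WellFormed B → IsHyperBouquet B → IsPlane B →
                  ∀ (k : ℕ) → partialDualPoly B k ≡ constPoly (2 ^ e# B) k
proposition4p10 B wf bouquet plane = partialDualPoly-allPlane B λ A →
  trans (eulerGenus-invariant (plane-bouquet-extremal bouquet plane) A) (proj₂ plane)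
  where open PartialDual B wf
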